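{- The plucking polynomial $Q(T)$ of a plane rooted tree does not depend on the plane embedding: if $T$ and $T'$ are two plane embeddings of the same (abstract) rooted tree, with the same root, then $Q(T)=Q(T')$. Hence $Q$ is an invariant of rooted trees.
   Context: A plane rooted tree is a finite tree with a distinguished vertex (the root), embedded in the plane so that it grows upward from the root. A leaf is a vertex of degree $1$ different from the root. For a leaf $v$ of $T$, $r(T,v)$ denotes the number of edges of $T$ lying to the right of the unique path connecting $v$ with the root, and $T-v$ is the plane rooted tree obtained by deleting $v$ and its incident edge. The plucking polynomial $Q(T)\in\mathbb{Z}[q]$ is defined recursively: if $T$ has a single vertex then $Q(T)=1$; otherwise $Q(T)=\sum_{v \text{ leaf of } T} q^{r(T,v)}Q(T-v)$. -}

module Defs where

open import Data.Nat using (ℕ; zero; suc; _+_)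
open import Data.Integer using (ℤ; 0ℤ; 1ℤ) renaming (_+_ to _+ℤ_)
open import Data.List using (List; []; _∷_; map; foldr; _++_)
open import Data.List.Relation.Binary.Permutation.Propositional using (_↭_)
open import Data.List.Relation.Binary.Pointwise using (Pointwise)

-- Plane rooted trees: a root together with the left-to-right ordered list
-- of the plane rooted trees growing from its children.
data PTree : Set where
  node : List PTree → PTree

-- Number of vertices of a tree / of a forest (list of trees).
-- For a forest hanging below a vertex this is also the number of edges
-- of the forest plus the edges joining it to that vertex.
mutual
  size : PTree → ℕ
  size (node ts) = suc (sizeF ts)

  sizeF : List PTree → ℕ
  sizeF []       = 0
  sizeF (t ∷ ts) = size t + sizeF ts

-- Leaves of the forest of children of a vertex (a leaf of a tree node ts
-- is a leaf in the forest ts; the root itself is never a leaf).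
data LeafF : List PTree → Set where
  here  : ∀ {ts}    → LeafF (node [] ∷ ts)
  down  : ∀ {us ts} → LeafF us → LeafF (node us ∷ ts)
  there : ∀ {t ts}  → LeafF ts → LeafF (t ∷ ts)

Leaf : PTree → Set
Leaf (node ts) = LeafF ts

removeF : (ts : List PTree) → LeafF ts → List PTree
removeF (node [] ∷ ts) here      = ts
removeF (node us ∷ ts) (down l)  = node (removeF us l) ∷ ts
removeF (t ∷ ts)       (there l) = t ∷ removeF ts l

_-ᵀ_ : (T : PTree) → Leaf T → PTree
node ts -ᵀ l = node (removeF ts l)

-- r(T,v): the number of edges lying to the right of the path from v to the
-- root, i.e. all edges of the subtrees hanging to the right of that path
-- (each such subtree contributes its vertex count: its internal edges plus
-- the edge joining it to the path).
rF : (ts : List PTree) → LeafF ts → ℕ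
rF (node [] ∷ ts) here      = sizeF ts
rF (node us ∷ ts) (down l)  = rF us l + sizeF ts
rF (t ∷ ts)       (there l) = rF ts l

r : (T : PTree) → Leaf T → ℕ
r (node ts) l = rF ts l

leavesF : (ts : List PTree) → List (LeafF ts)
leavesF []                   = []
leavesF (node [] ∷ ts)       = here ∷ map there (leavesF ts)
leavesF (node (u ∷ us) ∷ ts) = map down (leavesF (u ∷ us)) ++ map there (leavesF ts)

leaves : (T : PTree) → List (Leaf T)
leaves (node ts) = leavesF ts

-- Polynomials in ℤ[q], represented by their coefficient sequences
-- (p n = coefficient of q^n); equality of polynomials is pointwise equality.
Poly : Set
Poly = ℕ → ℤ

zeroP : Poly
zeroP _ = 0ℤ

oneP : Poly
oneP zero    = 1ℤ
oneP (suc _) = 0ℤ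

_+P_ : Poly → Poly → Poly
(p +P q) n = p n +ℤ q n

shiftP : ℕ → Poly → Poly
shiftP zero    p n       = p n
shiftP (suc k) p zero    = 0ℤ
shiftP (suc k) p (suc n) = shiftP k p n

sumP : List Poly → Poly
sumP = foldr _+P_ zeroP

-- Plucking polynomial, by recursion with a fuel argument (the fuel
-- sizeF ts strictly decreases on deleting a leaf, and is exactly enough).
QF : ℕ → List PTree → Poly
QF _       []         = oneP
QF zero    (_ ∷ _)    = zeroP   -- unreachable with the fuel used below
QF (suc n) ts@(_ ∷ _) =
  sumP (map (λ l → shiftP (rF ts l) (QF n (removeF ts l))) (leavesF ts))

Q : PTree → Poly
Q (node ts) = QF (sizeF ts) ts

-- Two plane rooted trees are plane embeddings of the same abstract rooted
-- tree (with the same root) iff they are isomorphic as rooted trees: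
-- the children of the roots can be matched bijectively (a permutation)
-- so that matched subtrees are again isomorphic.
data _≅ᵀ_ : PTree → PTree → Set where
  node : ∀ {ts vs us} → ts ↭ vs → Pointwise _≅ᵀ_ vs us → node ts ≅ᵀ node us

module Submission where

-- We work with forests F (the ordered children of a root), writing Qᶠ F
-- for the plucking polynomial of the tree whose root carries F.  The key
-- fact is the product formula
--     Qᶠ (F ++ G) = [|F| + |G| choose |F|]_q · Qᶠ F · Qᶠ G,
-- proved by induction on |F| + |G|: a leaf plucked from F has all |G|
-- vertices of G to its right, a leaf plucked from G has nothing of F to
-- its right, and the two contributions combine by the q-Pascal rule.
-- Symmetry of the q-binomial is read off the same formula for a forest of
-- a + b leaves cut after a or after b leaves (cancelling a factor with
-- constant term 1).  Hence Qᶠ (F ++ G) = Qᶠ (G ++ F), so Qᶠ is invariant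
-- under permuting children; since putting a new root below a tree does not
-- change Q, induction on the isomorphism gives the corollary.

open import Defs
open import Data.Nat using (ℕ; zero; suc) renaming (_+_ to _+ℕ_)
import Data.Nat.Properties as ℕP
open import Data.Nat.ListAction using (sum)
open import Data.Nat.ListAction.Properties using (sum-↭)
open import Data.Integer using (ℤ; 1ℤ; _+_; _*_)
import Data.Integer.Properties as ℤP
open import Data.Integer.Solver using (module +-*-Solver)
open import Data.List using (List; []; _∷_; map; _++_; replicate)
open import Data.List.Properties using (++-identityʳ; ++-assoc; map-++; map-∘; map-id)
open import Data.List.Relation.Binary.Permutation.Propositional
  using (_↭_; refl; prep; swap; trans)
open import Data.List.Relation.Binary.Permutation.Propositional.Properties
  using (map⁺)
open import Data.List.Relation.Binary.Pointwise using (Pointwise; []; _∷_)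
open import Algebra.Bundles using (AbelianGroup)
open import Algebra.Properties.Group (AbelianGroup.group ℤP.+-0-abelianGroup)
  using (∙-cancelˡ)
open import Relation.Binary.Bundles using (Setoid)
open import Relation.Binary.PropositionalEquality
  using (_≡_; _≗_; _→-setoid_; cong; cong₂; subst₂; module ≡-Reasoning)
  renaming (refl to ≡-refl; sym to ≡-sym; trans to ≡-trans)
import Relation.Binary.Reasoning.Setoid as SetoidReasoning

open +-*-Solver using (solve; _:+_; _:*_; _:=_)

module ≈ = Setoid (ℕ →-setoid ℤ)
module ≈-Reasoning = SetoidReasoning (ℕ →-setoid ℤ)

tl : Poly → Poly
tl p n = p (suc n)

infixl 7 _*P_
_*P_ : Poly → Poly → Poly
(p *P r) zero    = p 0 * r 0
(p *P r) (suc n) = p 0 * r (suc n) + (tl p *P r) n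

+P-cong : ∀ {p p′ r r′} → p ≗ p′ → r ≗ r′ → (p +P r) ≗ (p′ +P r′)
+P-cong e e′ n = cong₂ _+_ (e n) (e′ n)

+P-congʳ : ∀ p {r r′} → r ≗ r′ → (p +P r) ≗ (p +P r′)
+P-congʳ p e n = cong (p n +_) (e n)

*P-sucʳ : ∀ p r n → (p *P r) (suc n) ≡ r 0 * p (suc n) + (p *P tl r) n
*P-sucʳ p r zero = solve 4 (λ a b c d → a :* b :+ c :* d := d :* c :+ a :* b)
  ≡-refl (p 0) (r 1) (p 1) (r 0)
*P-sucʳ p r (suc n) rewrite *P-sucʳ (tl p) r n =
  solve 4 (λ a b c d → a :+ (b :+ d) := b :+ (a :+ d)) ≡-refl
    (p 0 * r (suc (suc n))) (r 0 * p (suc (suc n)))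
    (p 0 * r (suc (suc n))) ((tl p *P tl r) n)

*P-comm : ∀ p r → (p *P r) ≗ (r *P p)
*P-comm p r zero    = ℤP.*-comm (p 0) (r 0)
*P-comm p r (suc n) rewrite *P-sucʳ r p n | *P-comm (tl p) r n = ≡-refl

*P-congˡ : ∀ {p p′} r → p ≗ p′ → (p *P r) ≗ (p′ *P r)
*P-congˡ r e zero    = cong (_* r 0) (e 0)
*P-congˡ r e (suc n) =
  cong₂ _+_ (cong (_* r (suc n)) (e 0)) (*P-congˡ r (λ i → e (suc i)) n)

*P-congʳ : ∀ p {r r′} → r ≗ r′ → (p *P r) ≗ (p *P r′)
*P-congʳ p {r} {r′} e = ≈.trans (*P-comm p r) (≈.trans (*P-congˡ p e) (*P-comm r′ p))

zero-*P : ∀ p → (zeroP *P p) ≗ zeroP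
zero-*P p zero    = ≡-refl
zero-*P p (suc n) rewrite zero-*P p n = ≡-refl

*P-zero : ∀ p → (p *P zeroP) ≗ zeroP
*P-zero p = ≈.trans (*P-comm p zeroP) (zero-*P p)

one-*P : ∀ p → (oneP *P p) ≗ p
one-*P p zero    = ℤP.*-identityˡ (p 0)
one-*P p (suc n) rewrite zero-*P p n =
  ≡-trans (ℤP.+-identityʳ _) (ℤP.*-identityˡ (p (suc n)))

*P-one : ∀ p → (p *P oneP) ≗ p
*P-one p = ≈.trans (*P-comm p oneP) (one-*P p)

*P-distribʳ : ∀ p p′ r → ((p +P p′) *P r) ≗ ((p *P r) +P (p′ *P r))
*P-distribʳ p p′ r zero    = ℤP.*-distribʳ-+ (r 0) (p 0) (p′ 0)
*P-distribʳ p p′ r (suc n) rewrite *P-distribʳ (tl p) (tl p′) r n =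
  solve 5 (λ a b c d e → (a :+ b) :* c :+ (d :+ e) := (a :* c :+ d) :+ (b :* c :+ e))
    ≡-refl (p 0) (p′ 0) (r (suc n)) ((tl p *P r) n) ((tl p′ *P r) n)

*P-distribˡ : ∀ p r r′ → (p *P (r +P r′)) ≗ ((p *P r) +P (p *P r′))
*P-distribˡ p r r′ = ≈.trans (*P-comm p (r +P r′))
  (≈.trans (*P-distribʳ r r′ p) (+P-cong (*P-comm r p) (*P-comm r′ p)))

*P-cancelʳ : ∀ {u} c d → u 0 ≡ 1ℤ → (c *P u) ≗ (d *P u) → c ≗ d
*P-cancelʳ {u} c d u₀ e zero = begin
  c 0          ≡⟨ ≡-sym (ℤP.*-identityʳ (c 0)) ⟩
  c 0 * 1ℤ     ≡⟨ cong (c 0 *_) (≡-sym u₀) ⟩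
  c 0 * u 0    ≡⟨ e 0 ⟩
  d 0 * u 0    ≡⟨ cong (d 0 *_) u₀ ⟩
  d 0 * 1ℤ     ≡⟨ ℤP.*-identityʳ (d 0) ⟩
  d 0          ∎
  where open ≡-Reasoning
*P-cancelʳ {u} c d u₀ e (suc n) = *P-cancelʳ (tl c) (tl d) u₀ tails n
  where
  c₀≡d₀ : c 0 ≡ d 0
  c₀≡d₀ = *P-cancelʳ c d u₀ e 0
  tails : (tl c *P u) ≗ (tl d *P u)
  tails m = ∙-cancelˡ (d 0 * u (suc m)) _ _
    (≡-trans (cong (λ x → x * u (suc m) + (tl c *P u) m) (≡-sym c₀≡d₀)) (e (suc m)))

shiftP-cong : ∀ k {p r} → p ≗ r → shiftP k p ≗ shiftP k r
shiftP-cong zero    e n       = e n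
shiftP-cong (suc k) e zero    = ≡-refl
shiftP-cong (suc k) e (suc n) = shiftP-cong k e n

shiftP-+ : ∀ m k p → shiftP (m +ℕ k) p ≗ shiftP m (shiftP k p)
shiftP-+ zero    k p n       = ≡-refl
shiftP-+ (suc m) k p zero    = ≡-refl
shiftP-+ (suc m) k p (suc n) = shiftP-+ m k p n

shiftP-*Pˡ : ∀ k p r → (shiftP k p *P r) ≗ shiftP k (p *P r)
shiftP-*Pˡ zero    p r n       = ≡-refl
shiftP-*Pˡ (suc k) p r zero    = ℤP.*-zeroˡ (r 0)
shiftP-*Pˡ (suc k) p r (suc n) rewrite ℤP.*-zeroˡ (r (suc n)) =
  ≡-trans (ℤP.+-identityˡ _) (shiftP-*Pˡ k p r n)

shiftP-*Pʳ : ∀ k p r → (p *P shiftP k r) ≗ shiftP k (p *P r)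
shiftP-*Pʳ k p r = ≈.trans (*P-comm p (shiftP k r))
  (≈.trans (shiftP-*Pˡ k r p) (shiftP-cong k (*P-comm r p)))

ΣL : {A : Set} → List A → (A → Poly) → Poly
ΣL xs f = sumP (map f xs)

ΣL-cong : {A : Set} (xs : List A) {f g : A → Poly} → (∀ x → f x ≗ g x) → ΣL xs f ≗ ΣL xs g
ΣL-cong []       e = ≈.refl
ΣL-cong (x ∷ xs) e = +P-cong (e x) (ΣL-cong xs e)

ΣL-++ : {A : Set} (xs ys : List A) (f : A → Poly) → ΣL (xs ++ ys) f ≗ (ΣL xs f +P ΣL ys f)
ΣL-++ []       ys f n = ≡-sym (ℤP.+-identityˡ _)
ΣL-++ (x ∷ xs) ys f n rewrite ΣL-++ xs ys f n = ≡-sym (ℤP.+-assoc (f x n) _ _)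

ΣL-map : {A B : Set} (h : A → B) (xs : List A) (f : B → Poly) →
  ΣL (map h xs) f ≗ ΣL xs (λ x → f (h x))
ΣL-map h []       f = ≈.refl
ΣL-map h (x ∷ xs) f = +P-congʳ (f (h x)) (ΣL-map h xs f)

ΣL-*Pˡ : {A : Set} (c : Poly) (xs : List A) (f : A → Poly) →
  ΣL xs (λ x → c *P f x) ≗ (c *P ΣL xs f)
ΣL-*Pˡ c []       f = ≈.sym (*P-zero c)
ΣL-*Pˡ c (x ∷ xs) f =
  ≈.trans (+P-congʳ (c *P f x) (ΣL-*Pˡ c xs f)) (≈.sym (*P-distribˡ c (f x) (ΣL xs f)))

ΣL-*Pʳ : {A : Set} (c : Poly) (xs : List A) (f : A → Poly) →
  ΣL xs (λ x → f x *P c) ≗ (ΣL xs f *P c)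
ΣL-*Pʳ c xs f = ≈.trans (ΣL-cong xs (λ x → *P-comm (f x) c))
  (≈.trans (ΣL-*Pˡ c xs f) (*P-comm c (ΣL xs f)))

Qᶠ : List PTree → Poly
Qᶠ F = QF (sizeF F) F

term : (F : List PTree) → LeafF F → Poly
term F l = shiftP (rF F l) (Qᶠ (removeF F l))

sizeF-++ : ∀ F G → sizeF (F ++ G) ≡ sizeF F +ℕ sizeF G
sizeF-++ []      G = ≡-refl
sizeF-++ (t ∷ F) G rewrite sizeF-++ F G = ≡-sym (ℕP.+-assoc (size t) (sizeF F) (sizeF G))

sizeF-removeF : ∀ F (l : LeafF F) → suc (sizeF (removeF F l)) ≡ sizeF F
sizeF-removeF (node [] ∷ F)       here      = ≡-refl
sizeF-removeF (node (u ∷ us) ∷ F) (down l)  = cong (λ s → suc s +ℕ sizeF F) (sizeF-removeF (u ∷ us) l)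
sizeF-removeF (node [] ∷ F)       (there l) = cong suc (sizeF-removeF F l)
sizeF-removeF (node (u ∷ us) ∷ F) (there l) =
  ≡-trans (≡-sym (ℕP.+-suc (size (node (u ∷ us))) (sizeF (removeF F l))))
          (cong (size (node (u ∷ us)) +ℕ_) (sizeF-removeF F l))

-- The fuel in the definition of Q is exactly the size, so Qᶠ of a
-- nonempty forest is the sum of the terms of its leaves.
Qᶠ-unfold : ∀ us F → Qᶠ (node us ∷ F) ≗ ΣL (leavesF (node us ∷ F)) (term (node us ∷ F))
Qᶠ-unfold us F = ΣL-cong (leavesF (node us ∷ F)) λ l n →
  cong (λ s → shiftP (rF (node us ∷ F) l) (QF s (removeF (node us ∷ F) l)) n)
       (ℕP.suc-injective (≡-sym (sizeF-removeF (node us ∷ F) l)))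

inl : ∀ {F} G → LeafF F → LeafF (F ++ G)
inl G here      = here
inl G (down l)  = down l
inl G (there l) = there (inl G l)

inr : ∀ F {G} → LeafF G → LeafF (F ++ G)
inr []      l = l
inr (t ∷ F) l = there (inr F l)

leavesF-++ : ∀ F G → leavesF (F ++ G) ≡ map (inl G) (leavesF F) ++ map (inr F) (leavesF G)
leavesF-++ []                   G = ≡-sym (map-id (leavesF G))
leavesF-++ (node [] ∷ F)        G = cong (here ∷_) (begin
  map there (leavesF (F ++ G))
    ≡⟨ cong (map there) (leavesF-++ F G) ⟩
  map there (map (inl G) LF ++ map (inr F) LG)
    ≡⟨ map-++ there (map (inl G) LF) (map (inr F) LG) ⟩
  map there (map (inl G) LF) ++ map there (map (inr F) LG)
    ≡⟨ cong₂ _++_ (≡-trans (≡-sym (map-∘ LF)) (map-∘ LF)) (≡-sym (map-∘ LG)) ⟩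
  map (inl G) (map there LF) ++ map (inr (node [] ∷ F)) LG ∎)
  where open ≡-Reasoning
        LF = leavesF F
        LG = leavesF G
leavesF-++ (node (u ∷ us) ∷ F)  G = begin
  map down LU ++ map there (leavesF (F ++ G))
    ≡⟨ cong (λ xs → map down LU ++ map there xs) (leavesF-++ F G) ⟩
  map down LU ++ map there (map (inl G) LF ++ map (inr F) LG)
    ≡⟨ cong (map down LU ++_) (map-++ there (map (inl G) LF) (map (inr F) LG)) ⟩
  map down LU ++ (map there (map (inl G) LF) ++ map there (map (inr F) LG))
    ≡⟨ ≡-sym (++-assoc (map down LU) _ _) ⟩
  (map down LU ++ map there (map (inl G) LF)) ++ map there (map (inr F) LG)
    ≡⟨ cong₂ _++_ (cong₂ _++_ (map-∘ LU) (≡-trans (≡-sym (map-∘ LF)) (map-∘ LF)))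
                  (≡-sym (map-∘ LG)) ⟩
  (map (inl G) (map down LU) ++ map (inl G) (map there LF)) ++ map (inr (node (u ∷ us) ∷ F)) LG
    ≡⟨ cong (_++ map (inr (node (u ∷ us) ∷ F)) LG)
            (≡-sym (map-++ (inl G) (map down LU) (map there LF))) ⟩
  map (inl G) (map down LU ++ map there LF) ++ map (inr (node (u ∷ us) ∷ F)) LG ∎
  where open ≡-Reasoning
        LU = leavesF (u ∷ us)
        LF = leavesF F
        LG = leavesF G

ΣL-leavesF-++ : ∀ F G (f : LeafF (F ++ G) → Poly) →
  ΣL (leavesF (F ++ G)) f ≗ (ΣL (leavesF F) (λ l → f (inl G l)) +P ΣL (leavesF G) (λ l → f (inr F l)))
ΣL-leavesF-++ F G f n rewrite leavesF-++ F G =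
  ≡-trans (ΣL-++ (map (inl G) (leavesF F)) (map (inr F) (leavesF G)) f n)
          (+P-cong (ΣL-map (inl G) (leavesF F) f) (ΣL-map (inr F) (leavesF G) f) n)

rF-inl : ∀ F G (l : LeafF F) → rF (F ++ G) (inl G l) ≡ rF F l +ℕ sizeF G
rF-inl (node [] ∷ F)       G here      = sizeF-++ F G
rF-inl (node (u ∷ us) ∷ F) G (down l)  rewrite sizeF-++ F G =
  ≡-sym (ℕP.+-assoc (rF (u ∷ us) l) (sizeF F) (sizeF G))
rF-inl (node [] ∷ F)       G (there l) = rF-inl F G l
rF-inl (node (u ∷ us) ∷ F) G (there l) = rF-inl F G l

removeF-inl : ∀ F G (l : LeafF F) → removeF (F ++ G) (inl G l) ≡ removeF F l ++ G
removeF-inl (node [] ∷ F)       G here      = ≡-refl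
removeF-inl (node (u ∷ us) ∷ F) G (down l)  = ≡-refl
removeF-inl (node [] ∷ F)       G (there l) = cong (node [] ∷_) (removeF-inl F G l)
removeF-inl (node (u ∷ us) ∷ F) G (there l) = cong (node (u ∷ us) ∷_) (removeF-inl F G l)

rF-inr : ∀ F G (l : LeafF G) → rF (F ++ G) (inr F l) ≡ rF G l
rF-inr []                  G l = ≡-refl
rF-inr (node [] ∷ F)       G l = rF-inr F G l
rF-inr (node (u ∷ us) ∷ F) G l = rF-inr F G l

removeF-inr : ∀ F G (l : LeafF G) → removeF (F ++ G) (inr F l) ≡ F ++ removeF G l
removeF-inr []                  G l = ≡-refl
removeF-inr (node [] ∷ F)       G l = cong (node [] ∷_) (removeF-inr F G l)
removeF-inr (node (u ∷ us) ∷ F) G l = cong (node (u ∷ us) ∷_) (removeF-inr F G l)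

term-inl : ∀ F G (l : LeafF F) →
  term (F ++ G) (inl G l) ≡ shiftP (rF F l +ℕ sizeF G) (Qᶠ (removeF F l ++ G))
term-inl F G l = cong₂ (λ k H → shiftP k (Qᶠ H)) (rF-inl F G l) (removeF-inl F G l)

term-inr : ∀ F G (l : LeafF G) →
  term (F ++ G) (inr F l) ≡ shiftP (rF G l) (Qᶠ (F ++ removeF G l))
term-inr F G l = cong₂ (λ k H → shiftP k (Qᶠ H)) (rF-inr F G l) (removeF-inr F G l)

-- qbinom a b is the q-binomial coefficient [a + b choose a]_q, defined
-- by the q-Pascal recurrence.
qbinom : ℕ → ℕ → Poly
qbinom zero    b       = oneP
qbinom (suc a) zero    = oneP
qbinom (suc a) (suc b) = shiftP (suc b) (qbinom a (suc b)) +P qbinom (suc a) b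

ProductFormula : List PTree → List PTree → Set
ProductFormula F G = Qᶠ (F ++ G) ≗ (qbinom (sizeF F) (sizeF G) *P (Qᶠ F *P Qᶠ G))

pluck-left : ∀ F G (l : LeafF F) {a} → sizeF (removeF F l) ≡ a → ProductFormula (removeF F l) G →
  term (F ++ G) (inl G l) ≗ (shiftP (sizeF G) (qbinom a (sizeF G)) *P (term F l *P Qᶠ G))
pluck-left F G l ≡-refl formula = begin
  term (F ++ G) (inl G l)                 ≡⟨ term-inl F G l ⟩
  shiftP (k +ℕ g) (Qᶠ (removeF F l ++ G)) ≈⟨ shiftP-cong (k +ℕ g) formula ⟩
  shiftP (k +ℕ g) (B *P Y)                ≈⟨ shiftP-+ k g (B *P Y) ⟩
  shiftP k (shiftP g (B *P Y))            ≈⟨ shiftP-cong k (≈.sym (shiftP-*Pˡ g B Y)) ⟩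
  shiftP k (shiftP g B *P Y)              ≈⟨ ≈.sym (shiftP-*Pʳ k (shiftP g B) Y) ⟩
  shiftP g B *P shiftP k Y                ≈⟨ *P-congʳ (shiftP g B) (≈.sym (shiftP-*Pˡ k _ (Qᶠ G))) ⟩
  shiftP g B *P (term F l *P Qᶠ G)        ∎
  where
  open ≈-Reasoning
  k g : ℕ
  k = rF F l
  g = sizeF G
  B Y : Poly
  B = qbinom (sizeF (removeF F l)) g
  Y = Qᶠ (removeF F l) *P Qᶠ G

pluck-right : ∀ F G (l : LeafF G) {b} → sizeF (removeF G l) ≡ b → ProductFormula F (removeF G l) →
  term (F ++ G) (inr F l) ≗ (qbinom (sizeF F) b *P (Qᶠ F *P term G l))
pluck-right F G l ≡-refl formula = begin
  term (F ++ G) (inr F l)                ≡⟨ term-inr F G l ⟩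
  shiftP k (Qᶠ (F ++ removeF G l))       ≈⟨ shiftP-cong k formula ⟩
  shiftP k (B *P (Qᶠ F *P Qᶠ G′))        ≈⟨ ≈.sym (shiftP-*Pʳ k B _) ⟩
  B *P shiftP k (Qᶠ F *P Qᶠ G′)          ≈⟨ *P-congʳ B (≈.sym (shiftP-*Pʳ k (Qᶠ F) (Qᶠ G′))) ⟩
  B *P (Qᶠ F *P term G l)                ∎
  where
  open ≈-Reasoning
  k : ℕ
  k = rF G l
  G′ : List PTree
  G′ = removeF G l
  B : Poly
  B = qbinom (sizeF F) (sizeF G′)

ΣL-pluck-left : ∀ us F G → (∀ l → ProductFormula (removeF (node us ∷ F) l) G) →
  ΣL (leavesF (node us ∷ F)) (λ l → term ((node us ∷ F) ++ G) (inl G l))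
  ≗ (shiftP (sizeF G) (qbinom (sizeF us +ℕ sizeF F) (sizeF G)) *P (Qᶠ (node us ∷ F) *P Qᶠ G))
ΣL-pluck-left us F G formula = begin
  ΣL (leavesF Fs) (λ l → term (Fs ++ G) (inl G l))
    ≈⟨ ΣL-cong (leavesF Fs) (λ l →
         pluck-left Fs G l (ℕP.suc-injective (sizeF-removeF Fs l)) (formula l)) ⟩
  ΣL (leavesF Fs) (λ l → C *P (term Fs l *P Qᶠ G)) ≈⟨ ΣL-*Pˡ C (leavesF Fs) _ ⟩
  C *P ΣL (leavesF Fs) (λ l → term Fs l *P Qᶠ G)   ≈⟨ *P-congʳ C (ΣL-*Pʳ (Qᶠ G) (leavesF Fs) (term Fs)) ⟩
  C *P (ΣL (leavesF Fs) (term Fs) *P Qᶠ G)         ≈⟨ *P-congʳ C (*P-congˡ (Qᶠ G) (≈.sym (Qᶠ-unfold us F))) ⟩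
  C *P (Qᶠ Fs *P Qᶠ G)                             ∎
  where
  open ≈-Reasoning
  Fs : List PTree
  Fs = node us ∷ F
  C : Poly
  C = shiftP (sizeF G) (qbinom (sizeF us +ℕ sizeF F) (sizeF G))

ΣL-pluck-right : ∀ F vs G → (∀ l → ProductFormula F (removeF (node vs ∷ G) l)) →
  ΣL (leavesF (node vs ∷ G)) (λ l → term (F ++ node vs ∷ G) (inr F l))
  ≗ (qbinom (sizeF F) (sizeF vs +ℕ sizeF G) *P (Qᶠ F *P Qᶠ (node vs ∷ G)))
ΣL-pluck-right F vs G formula = begin
  ΣL (leavesF Gs) (λ l → term (F ++ Gs) (inr F l))
    ≈⟨ ΣL-cong (leavesF Gs) (λ l →
         pluck-right F Gs l (ℕP.suc-injective (sizeF-removeF Gs l)) (formula l)) ⟩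
  ΣL (leavesF Gs) (λ l → D *P (Qᶠ F *P term Gs l)) ≈⟨ ΣL-*Pˡ D (leavesF Gs) _ ⟩
  D *P ΣL (leavesF Gs) (λ l → Qᶠ F *P term Gs l)   ≈⟨ *P-congʳ D (ΣL-*Pˡ (Qᶠ F) (leavesF Gs) (term Gs)) ⟩
  D *P (Qᶠ F *P ΣL (leavesF Gs) (term Gs))         ≈⟨ *P-congʳ D (*P-congʳ (Qᶠ F) (≈.sym (Qᶠ-unfold vs G))) ⟩
  D *P (Qᶠ F *P Qᶠ Gs)                             ∎
  where
  open ≈-Reasoning
  Gs : List PTree
  Gs = node vs ∷ G
  D : Poly
  D = qbinom (sizeF F) (sizeF vs +ℕ sizeF G)

productFormula-by-size : ∀ k F G → sizeF F +ℕ sizeF G ≡ k → ProductFormula F G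
productFormula-by-size _ [] G _ = ≈.sym (≈.trans (one-*P _) (one-*P _))
productFormula-by-size _ (node us ∷ F) [] _ rewrite ++-identityʳ F = ≈.sym (≈.trans (one-*P _) (*P-one _))
productFormula-by-size zero (node us ∷ F) (node vs ∷ G) ()
productFormula-by-size (suc k) (node us ∷ F) (node vs ∷ G) e = begin
  Qᶠ (Fs ++ Gs)                             ≈⟨ Qᶠ-unfold us (F ++ Gs) ⟩
  ΣL (leavesF (Fs ++ Gs)) (term (Fs ++ Gs)) ≈⟨ ΣL-leavesF-++ Fs Gs (term (Fs ++ Gs)) ⟩
  ΣL (leavesF Fs) (λ l → term (Fs ++ Gs) (inl Gs l)) +P ΣL (leavesF Gs) (λ l → term (Fs ++ Gs) (inr Fs l))
    ≈⟨ +P-cong (ΣL-pluck-left us F Gs formula-left) (ΣL-pluck-right Fs vs G formula-right) ⟩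
  (C *P X) +P (D *P X)                      ≈⟨ ≈.sym (*P-distribʳ C D X) ⟩
  qbinom (sizeF Fs) (sizeF Gs) *P X         ∎
  where
  open ≈-Reasoning
  Fs Gs : List PTree
  Fs = node us ∷ F
  Gs = node vs ∷ G
  C D X : Poly
  C = shiftP (sizeF Gs) (qbinom (sizeF us +ℕ sizeF F) (sizeF Gs))
  D = qbinom (sizeF Fs) (sizeF vs +ℕ sizeF G)
  X = Qᶠ Fs *P Qᶠ Gs
  formula-left : ∀ l → ProductFormula (removeF Fs l) Gs
  formula-left l = productFormula-by-size k (removeF Fs l) Gs
    (ℕP.suc-injective (≡-trans (cong (_+ℕ sizeF Gs) (sizeF-removeF Fs l)) e))
  formula-right : ∀ l → ProductFormula Fs (removeF Gs l)
  formula-right l = productFormula-by-size k Fs (removeF Gs l)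
    (ℕP.suc-injective (≡-trans (≡-sym (ℕP.+-suc (sizeF Fs) (sizeF (removeF Gs l))))
                               (≡-trans (cong (sizeF Fs +ℕ_) (sizeF-removeF Gs l)) e)))

productFormula : ∀ F G → ProductFormula F G
productFormula F G = productFormula-by-size _ F G ≡-refl

qbinom-const : ∀ a b → qbinom a b 0 ≡ 1ℤ
qbinom-const zero    b       = ≡-refl
qbinom-const (suc a) zero    = ≡-refl
qbinom-const (suc a) (suc b) = ≡-trans (ℤP.+-identityˡ _) (qbinom-const (suc a) b)

leafForest : ℕ → List PTree
leafForest n = replicate n (node [])

sizeF-leafForest : ∀ n → sizeF (leafForest n) ≡ n
sizeF-leafForest zero    = ≡-refl
sizeF-leafForest (suc n) = cong suc (sizeF-leafForest n)

leafForest-++ : ∀ a b → leafForest a ++ leafForest b ≡ leafForest (a +ℕ b)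
leafForest-++ zero    b = ≡-refl
leafForest-++ (suc a) b = cong (node [] ∷_) (leafForest-++ a b)

Qᶠ-leafForest-const : ∀ n → Qᶠ (leafForest n) 0 ≡ 1ℤ
Qᶠ-leafForest-const zero    = ≡-refl
Qᶠ-leafForest-const (suc n) = begin
  Qᶠ (node [] ∷ leafForest n) 0                   ≡⟨ productFormula (node [] ∷ []) (leafForest n) 0 ⟩
  qbinom 1 (sizeF (leafForest n)) 0 * (1ℤ * Qᶠ (leafForest n) 0)
    ≡⟨ cong₂ (λ x y → x * (1ℤ * y))
             (qbinom-const 1 (sizeF (leafForest n))) (Qᶠ-leafForest-const n) ⟩
  1ℤ                                              ∎
  where open ≡-Reasoning

-- Cutting the (a + b)-star after a or after b leaves gives the same
-- forest, so the product formula forces [a+b choose a]_q = [a+b choose b]_q.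
qbinom-sym : ∀ a b → qbinom a b ≗ qbinom b a
qbinom-sym a b = *P-cancelʳ (qbinom a b) (qbinom b a) u-const (begin
  qbinom a b *P u                             ≈⟨ ≈.sym (star a b) ⟩
  Qᶠ (leafForest a ++ leafForest b)           ≡⟨ cong Qᶠ same-forest ⟩
  Qᶠ (leafForest b ++ leafForest a)           ≈⟨ star b a ⟩
  qbinom b a *P (Qᶠ (leafForest b) *P Qᶠ (leafForest a))
                                              ≈⟨ *P-congʳ (qbinom b a) (*P-comm _ _) ⟩
  qbinom b a *P u                             ∎)
  where
  open ≈-Reasoning
  u : Poly
  u = Qᶠ (leafForest a) *P Qᶠ (leafForest b)
  u-const : u 0 ≡ 1ℤ
  u-const = cong₂ _*_ (Qᶠ-leafForest-const a) (Qᶠ-leafForest-const b)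
  star : ∀ i j → Qᶠ (leafForest i ++ leafForest j) ≗
                   (qbinom i j *P (Qᶠ (leafForest i) *P Qᶠ (leafForest j)))
  star i j = subst₂ (λ x y → Qᶠ (leafForest i ++ leafForest j) ≗
                               (qbinom x y *P (Qᶠ (leafForest i) *P Qᶠ (leafForest j))))
                    (sizeF-leafForest i) (sizeF-leafForest j)
                    (productFormula (leafForest i) (leafForest j))
  same-forest : leafForest a ++ leafForest b ≡ leafForest b ++ leafForest a
  same-forest = ≡-trans (leafForest-++ a b)
                  (≡-trans (cong leafForest (ℕP.+-comm a b)) (≡-sym (leafForest-++ b a)))

Qᶠ-++-cong : ∀ {F F′ G G′} → sizeF F ≡ sizeF F′ → sizeF G ≡ sizeF G′ →
  Qᶠ F ≗ Qᶠ F′ → Qᶠ G ≗ Qᶠ G′ → Qᶠ (F ++ G) ≗ Qᶠ (F′ ++ G′)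
Qᶠ-++-cong {F} {F′} {G} {G′} sizes-F sizes-G Q-F Q-G = begin
  Qᶠ (F ++ G)                                      ≈⟨ productFormula F G ⟩
  qbinom (sizeF F) (sizeF G) *P (Qᶠ F *P Qᶠ G)
    ≡⟨ cong₂ (λ i j → qbinom i j *P (Qᶠ F *P Qᶠ G)) sizes-F sizes-G ⟩
  qbinom (sizeF F′) (sizeF G′) *P (Qᶠ F *P Qᶠ G)
    ≈⟨ *P-congʳ _ (≈.trans (*P-congˡ (Qᶠ G) Q-F) (*P-congʳ (Qᶠ F′) Q-G)) ⟩
  qbinom (sizeF F′) (sizeF G′) *P (Qᶠ F′ *P Qᶠ G′) ≈⟨ ≈.sym (productFormula F′ G′) ⟩
  Qᶠ (F′ ++ G′)                                    ∎
  where open ≈-Reasoning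

Qᶠ-++-comm : ∀ F G → Qᶠ (F ++ G) ≗ Qᶠ (G ++ F)
Qᶠ-++-comm F G = begin
  Qᶠ (F ++ G)                                  ≈⟨ productFormula F G ⟩
  qbinom (sizeF F) (sizeF G) *P (Qᶠ F *P Qᶠ G) ≈⟨ *P-congˡ _ (qbinom-sym (sizeF F) (sizeF G)) ⟩
  qbinom (sizeF G) (sizeF F) *P (Qᶠ F *P Qᶠ G) ≈⟨ *P-congʳ _ (*P-comm (Qᶠ F) (Qᶠ G)) ⟩
  qbinom (sizeF G) (sizeF F) *P (Qᶠ G *P Qᶠ F) ≈⟨ ≈.sym (productFormula G F) ⟩
  Qᶠ (G ++ F)                                  ∎
  where open ≈-Reasoning

sizeF-sum : ∀ F → sizeF F ≡ sum (map size F)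
sizeF-sum []      = ≡-refl
sizeF-sum (t ∷ F) = cong (size t +ℕ_) (sizeF-sum F)

↭-sizeF : ∀ {F G} → F ↭ G → sizeF F ≡ sizeF G
↭-sizeF {F} {G} p = ≡-trans (sizeF-sum F) (≡-trans (sum-↭ (map⁺ size p)) (≡-sym (sizeF-sum G)))

↭-Qᶠ : ∀ {F G} → F ↭ G → Qᶠ F ≗ Qᶠ G
↭-Qᶠ refl        = ≈.refl
↭-Qᶠ {_ ∷ F} {_ ∷ G} (prep t p) =
  Qᶠ-++-cong {t ∷ []} {t ∷ []} {F} {G} ≡-refl (↭-sizeF p) ≈.refl (↭-Qᶠ p)
↭-Qᶠ {_ ∷ _ ∷ F} {_ ∷ _ ∷ G} (swap t u p) = Qᶠ-++-cong {t ∷ u ∷ []} {u ∷ t ∷ []} {F} {G}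
  (↭-sizeF (swap t u (refl {xs = []}))) (↭-sizeF p) (Qᶠ-++-comm (t ∷ []) (u ∷ [])) (↭-Qᶠ p)
↭-Qᶠ (trans p q) = ≈.trans (↭-Qᶠ p) (↭-Qᶠ q)

-- Putting a new root below the tree node F does not change its polynomial:
-- the new edge lies on every leaf's path, so it is never to the right of
-- one.  Induction on the size k of F.
plant-by-size : ∀ k F → sizeF F ≡ k → Qᶠ (node F ∷ []) ≗ Qᶠ F
plant-by-size _       []            _ n = ℤP.+-identityʳ (oneP n)
plant-by-size zero    (node ws ∷ F) ()
plant-by-size (suc k) (node ws ∷ F) e = begin
  Qᶠ (node Fs ∷ [])                                     ≈⟨ Qᶠ-unfold Fs [] ⟩
  ΣL (map down (leavesF Fs) ++ []) (term (node Fs ∷ []))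
    ≡⟨ cong (λ ls → ΣL ls (term (node Fs ∷ []))) (++-identityʳ (map down (leavesF Fs))) ⟩
  ΣL (map down (leavesF Fs)) (term (node Fs ∷ []))      ≈⟨ ΣL-map down (leavesF Fs) _ ⟩
  ΣL (leavesF Fs) (λ l → term (node Fs ∷ []) (down l))  ≈⟨ ΣL-cong (leavesF Fs) term-down ⟩
  ΣL (leavesF Fs) (term Fs)                             ≈⟨ ≈.sym (Qᶠ-unfold ws F) ⟩
  Qᶠ Fs                                                 ∎
  where
  open ≈-Reasoning
  Fs : List PTree
  Fs = node ws ∷ F
  term-down : ∀ l → term (node Fs ∷ []) (down l) ≗ term Fs l
  term-down l = ≈.trans
    (≈.reflexive (cong (λ j → shiftP j (Qᶠ (node (removeF Fs l) ∷ []))) (ℕP.+-identityʳ (rF Fs l))))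
    (shiftP-cong (rF Fs l) (plant-by-size k (removeF Fs l)
       (ℕP.suc-injective (≡-trans (sizeF-removeF Fs l) e))))

plant : ∀ T → Qᶠ (T ∷ []) ≗ Q T
plant (node F) = plant-by-size _ F ≡-refl

mutual
  ≅-size : ∀ {T T′} → T ≅ᵀ T′ → size T ≡ size T′
  ≅-size (node p pw) = cong suc (≡-trans (↭-sizeF p) (pointwise-sizeF pw))

  pointwise-sizeF : ∀ {F G} → Pointwise _≅ᵀ_ F G → sizeF F ≡ sizeF G
  pointwise-sizeF []       = ≡-refl
  pointwise-sizeF (i ∷ pw) = cong₂ _+ℕ_ (≅-size i) (pointwise-sizeF pw)

mutual
  ≅-Q : ∀ {T T′} → T ≅ᵀ T′ → Q T ≗ Q T′
  ≅-Q (node p pw) = ≈.trans (↭-Qᶠ p) (pointwise-Qᶠ pw)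

  pointwise-Qᶠ : ∀ {F G} → Pointwise _≅ᵀ_ F G → Qᶠ F ≗ Qᶠ G
  pointwise-Qᶠ []                       = ≈.refl
  pointwise-Qᶠ {T ∷ F} {T′ ∷ G} (i ∷ pw) =
    Qᶠ-++-cong {T ∷ []} {T′ ∷ []} (cong (_+ℕ 0) (≅-size i)) (pointwise-sizeF pw)
      (≈.trans (plant T) (≈.trans (≅-Q i) (≈.sym (plant T′)))) (pointwise-Qᶠ pw)

corollary2p3 : (T T′ : PTree) → T ≅ᵀ T′ → (n : ℕ) → Q T n ≡ Q T′ n
corollary2p3 T T′ T≅T′ = ≅-Q T≅T′
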